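{- Let $\mathcal{F} \subset \mathcal{P}([n])$ be an $r$-closed $\theta$-intersecting family, where $r \geq 3$ and $\theta \in (0,1)$. Suppose $i, j \in S$ with $i < \theta j$. If $A \in \mathcal{F}(i)$ and $B \in \mathcal{F}(j)$, then $B \in \mathrm{Tor}(A)$. In particular, $i \in S_{\mathrm{nor}}$.
   Context: A family $\mathcal{F} \subset \mathcal{P}([n])$ is $r$-closed $\theta$-intersecting if for each $2 \leq t \leq r$ and any $t$ distinct sets $A_1,\dots,A_t \in \mathcal{F}$ we have $|A_1 \cap \dots \cap A_t| \in \{\theta|A_1|, \dots, \theta|A_t|\}$. $\mathcal{F}(i) := \mathcal{F} \cap \binom{[n]}{i}$. For $A \in \mathcal{F}$, $\mathrm{Tor}(A) := \{B \in \mathcal{F} : |B| \geq |A|,\ |A \cap B| = \theta|A|\}$. $S := \{i \in [n] : \mathcal{F}(i) \neq \emptyset\}$ and $S_{\mathrm{nor}} := \{i \in S : \mathrm{Tor}(A) \neq \emptyset \text{ for all } A \in \mathcal{F}(i)\}$.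
   Formalization: The parameter θ ranges over the rationals strictly between 0 and 1. -}

module Defs where

open import Data.Nat using (ℕ; _≤_; _≥_)
open import Data.Fin using (Fin)
open import Data.Fin.Subset using (Subset; _∩_; ⋂; ∣_∣)
open import Data.List using (tabulate)
open import Data.Rational using (ℚ; _*_)
open import Data.Integer using (+_)
import Data.Rational as ℚ
open import Data.Product using (Σ; _×_; ∃)
open import Function.Definitions using (Injective)
open import Relation.Binary.PropositionalEquality using (_≡_)

toℚ : ℕ → ℚ
toℚ k = ℚ._/_ (+ k) 1

Family : ℕ → Set₁
Family n = Subset n → Set

⋂ᶠ : ∀ {n t} → (Fin t → Subset n) → Subset n
⋂ᶠ As = ⋂ (tabulate As)

RClosedThetaIntersecting : ∀ {n} → ℕ → ℚ → Family n → Set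
RClosedThetaIntersecting {n} r θ F =
  ∀ (t : ℕ) → 2 ≤ t → t ≤ r →
  (As : Fin t → Subset n) → Injective _≡_ _≡_ As → (∀ k → F (As k)) →
  ∃ λ (k : Fin t) → (toℚ ∣ ⋂ᶠ As ∣) ≡ θ * (toℚ ∣ As k ∣)

InLevel : ∀ {n} → Family n → ℕ → Subset n → Set
InLevel F i A = F A × ∣ A ∣ ≡ i

Tor : ∀ {n} → ℚ → Family n → Subset n → Subset n → Set
Tor θ F A B = F B × ∣ B ∣ ≥ ∣ A ∣ × (toℚ ∣ A ∩ B ∣) ≡ θ * (toℚ ∣ A ∣)

InS : ∀ {n} → Family n → ℕ → Set
InS F i = ∃ λ A → InLevel F i A

InSnor : ∀ {n} → ℚ → Family n → ℕ → Set
InSnor θ F i = InS F i × (∀ A → InLevel F i A → ∃ λ B → Tor θ F A B)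

{-# OPTIONS --safe #-}
-- Two sets of F always meet in θ times the size of one of them. When |A| < θ|B|,
-- the intersection has size at most |A| < θ|B|, so it must be θ|A|: B ∈ Tor(A).
-- Only the pair condition (t = 2) and θ < 1 are needed.
module Submission where

open import Defs
open import Data.Nat using (ℕ; _≤_)
open import Data.Fin.Subset using (Subset)
open import Data.Rational using (ℚ; _<_; _*_; 0ℚ; 1ℚ)
open import Data.Product using (_×_)

import Data.Nat as ℕ
import Data.Nat.Properties as ℕP
import Data.Integer as ℤ
import Data.Integer.Properties as ℤP
import Data.Rational as ℚ
import Data.Rational.Properties as ℚP
open import Data.Nat.Coprimality using (1-coprimeTo)
import Data.Nat.Coprimality as Coprimality
open import Data.Fin using (Fin; zero; suc)
open import Data.Fin.Subset using (_∩_; ∣_∣)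
open import Data.Fin.Subset.Properties using (∣p∩q∣≤∣p∣; ∩-identityʳ)
open import Data.Product using (_,_)
open import Data.Sum using (_⊎_; inj₁; inj₂)
open import Data.Empty using (⊥-elim)
open import Function using (_∘_)
open import Function.Definitions using (Injective)
open import Relation.Binary.PropositionalEquality

toℚ-normal : ∀ k → toℚ k ≡ ℚ.mkℚ (ℤ.+ k) 0 (Coprimality.sym (1-coprimeTo k))
toℚ-normal k = ℚP.normalize-coprime (Coprimality.sym (1-coprimeTo k))

toℚ-mono-≤ : ∀ {m n} → m ≤ n → toℚ m ℚ.≤ toℚ n
toℚ-mono-≤ {m} {n} m≤n rewrite toℚ-normal m | toℚ-normal n =
  ℚ.*≤* (subst₂ ℤ._≤_ (sym (ℤP.*-identityʳ (ℤ.+ m))) (sym (ℤP.*-identityʳ (ℤ.+ n))) (ℤ.+≤+ m≤n))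

toℚ-cancel-< : ∀ {m n} → toℚ m < toℚ n → m ℕ.< n
toℚ-cancel-< {m} {n} lt rewrite toℚ-normal m | toℚ-normal n with lt
... | ℚ.*<* p = ℤP.drop‿+<+ (subst₂ ℤ._<_ (ℤP.*-identityʳ (ℤ.+ m)) (ℤP.*-identityʳ (ℤ.+ n)) p)

toℚ-nonNeg : ∀ k → ℚ.NonNegative (toℚ k)
toℚ-nonNeg k = ℚP.normalize-nonNeg k 1

*toℚ-contracting : ∀ {θ} k → θ < 1ℚ → θ * toℚ k ℚ.≤ toℚ k
*toℚ-contracting {θ} k θ<1 = subst (θ * toℚ k ℚ.≤_) (ℚP.*-identityˡ (toℚ k))
  (ℚP.*-monoʳ-≤-nonNeg (toℚ k) {{toℚ-nonNeg k}} (ℚP.<⇒≤ θ<1))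

<-*toℚ⇒< : ∀ {θ i j} → θ < 1ℚ → toℚ i < θ * toℚ j → i ℕ.< j
<-*toℚ⇒< {j = j} θ<1 i<θj = toℚ-cancel-< (ℚP.<-≤-trans i<θj (*toℚ-contracting j θ<1))

pair : ∀ {n} → Subset n → Subset n → Fin 2 → Subset n
pair A B zero       = A
pair A B (suc zero) = B

pair-injective : ∀ {n} {A B : Subset n} → A ≢ B → Injective _≡_ _≡_ (pair A B)
pair-injective A≢B {zero}     {zero}     _   = refl
pair-injective A≢B {zero}     {suc zero} A≡B = ⊥-elim (A≢B A≡B)
pair-injective A≢B {suc zero} {zero}     B≡A = ⊥-elim (A≢B (sym B≡A))
pair-injective A≢B {suc zero} {suc zero} _   = refl

⋂ᶠ-pair : ∀ {n} (A B : Subset n) → ⋂ᶠ (pair A B) ≡ A ∩ B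
⋂ᶠ-pair A B = cong (A ∩_) (∩-identityʳ B)

pair-θ-intersecting : ∀ {n r} θ {F : Family n} → 2 ≤ r → RClosedThetaIntersecting r θ F →
  ∀ {A B} → F A → F B → A ≢ B →
  toℚ ∣ A ∩ B ∣ ≡ θ * toℚ ∣ A ∣ ⊎ toℚ ∣ A ∩ B ∣ ≡ θ * toℚ ∣ B ∣
pair-θ-intersecting θ {F} 2≤r closed {A} {B} FA FB A≢B
  with closed 2 ℕP.≤-refl 2≤r (pair A B) (pair-injective A≢B) members
  where
  members : ∀ k → F (pair A B k)
  members zero       = FA
  members (suc zero) = FB
... | zero     , e = inj₁ (subst (λ X → toℚ ∣ X ∣ ≡ θ * toℚ ∣ A ∣) (⋂ᶠ-pair A B) e)
... | suc zero , e = inj₂ (subst (λ X → toℚ ∣ X ∣ ≡ θ * toℚ ∣ B ∣) (⋂ᶠ-pair A B) e)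

Tor-of-smaller : ∀ {n r} θ {F : Family n} → 2 ≤ r → θ < 1ℚ → RClosedThetaIntersecting r θ F →
  ∀ {A B} → F A → F B → toℚ ∣ A ∣ < θ * toℚ ∣ B ∣ → Tor θ F A B
Tor-of-smaller θ 2≤r θ<1 closed {A} {B} FA FB |A|<θ|B| =
  FB , ℕP.<⇒≤ |A|<|B| , intersection
  where
  |A|<|B| : ∣ A ∣ ℕ.< ∣ B ∣
  |A|<|B| = <-*toℚ⇒< θ<1 |A|<θ|B|

  |A∩B|<θ|B| : toℚ ∣ A ∩ B ∣ < θ * toℚ ∣ B ∣
  |A∩B|<θ|B| = ℚP.≤-<-trans (toℚ-mono-≤ (∣p∩q∣≤∣p∣ A B)) |A|<θ|B|

  A≢B : A ≢ B
  A≢B = ℕP.<⇒≢ |A|<|B| ∘ cong ∣_∣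

  intersection : toℚ ∣ A ∩ B ∣ ≡ θ * toℚ ∣ A ∣
  intersection with pair-θ-intersecting θ 2≤r closed FA FB A≢B
  ... | inj₁ e = e
  ... | inj₂ e = ⊥-elim (ℚP.<-irrefl e |A∩B|<θ|B|)

lemma2p13 : (n r : ℕ) (θ : ℚ) (F : Family n) →
    3 ≤ r → 0ℚ < θ → θ < 1ℚ →
    RClosedThetaIntersecting r θ F →
    (i j : ℕ) → InS F i → InS F j → toℚ i < θ * toℚ j →
    ((A B : Subset n) → InLevel F i A → InLevel F j B → Tor θ F A B)
    × InSnor θ F i
lemma2p13 n r θ F 3≤r _ θ<1 closed i j Sᵢ (B₀ , B₀∈Fⱼ) i<θj =
  level-Tor , Sᵢ , λ A A∈Fᵢ → B₀ , level-Tor A B₀ A∈Fᵢ B₀∈Fⱼ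
  where
  level-Tor : (A B : Subset n) → InLevel F i A → InLevel F j B → Tor θ F A B
  level-Tor A B (FA , refl) (FB , refl) =
    Tor-of-smaller θ {F} (ℕP.≤-trans (ℕP.n≤1+n 2) 3≤r) θ<1 closed FA FB i<θj
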